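{- Let $\mathcal{T}$ be a stratified $\mathcal{ELI}^{\bot}_{\preceq}$-TBox, $A(a)$ an instance query with $A$ a concept name of height $n$, and $\mathfrak{A}_A$ the $n$-nested NFA for $A$ constructed below. Then for every ABox $\mathcal{A}$: if $\mathcal{A}\models \exists x\,\mathfrak{A}_A(a,x)$, then $(\mathcal{A},\mathcal{T})\models A(a)$.
   Context: Description logic: roles are role names $r$ and inverses $\bar r$; $\mathcal{ELI}^\bot$ concepts $C::=\bot\mid\top\mid A\mid C\sqcap C\mid\exists s.C$ with standard semantics; $(\mathcal{A},\mathcal{T})\models A(a)$ means $a^{\mathcal{I}}\in A^{\mathcal{I}}$ in every model of ABox $\mathcal{A}$ and TBox $\mathcal{T}$. A TBox is in normal form if its GCIs have the forms $A\sqsubseteq B$, $A\sqcap B\sqsubseteq C$, $A\sqsubseteq\exists s.B$, $\exists s.A\sqsubseteq B$ ($A,B,C$ concept names, $\top$ or $\bot$; $\top,\bot$ not in conjunction GCIs; no $\exists s.\bot$). It is stratified w.r.t. a preorder $\preceq$ (strict part $\prec$) on its concept names (incl. $\top,\bot$) and roles (incl. inverses) if, for $A,B,C$ concept names and $D$ a concept name or $\top$: $A\sqsubseteq B\in\mathcal{T}\Rightarrow A\preceq B$; $A\sqcap B\sqsubseteq C\in\mathcal{T}\Rightarrow A\preceq C, B\preceq C$, and $A\prec C$ or $B\prec C$; $A\sqsubseteq\exists s.D\in\mathcal{T}\Rightarrow$ ($A\preceq D$ or $D=\top$) and $A\preceq s$; $\exists s.D\sqsubseteq B\in\mathcal{T}\Rightarrow$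 ($D\prec B$ or $D=B$ or $D=\top$) and $s\preceq D$; and $r\preceq\bar r\preceq r$ for role names $r$. Fix such a $\preceq$. The height of a concept or role name $\alpha$ is the length of the longest chain $\alpha_1\prec\cdots\prec\alpha_k$ with $\alpha_k=\alpha$; $\top,\bot$ have height $0$; $\exists s.A$ has height the maximum of the heights of $s$ and $A$. $\mathcal{T}|_n$ is the set of GCIs of $\mathcal{T}$ involving only concepts of height at most $n$ ($\mathcal{T}|_{ -1}=\emptyset$); $\mathrm{con}(\mathcal{T}|_n)$ is its set of concept names together with $\top,\bot$, and $\mathrm{rol}(\mathcal{T}|_n)$ its set of roles. Nested NFAs and runs: a 0-nested NFA is an NFA over a finite alphabet of roles and tests $C?$; an $(n{+}1)$-nested NFA may also use letters $\mathfrak{B}?$ for $n$-nested NFAs $\mathfrak{B}$. A run in interpretation $\mathcal{I}$ is a sequence $(d_0,q_0,w_1,q_1,d_1),\dots,(d_{\ell-1},q_{\ell-1},w_\ell,q_\ell,d_\ell)$ of transitions with: $w=r$ requires $(d_i,d_{i+1})\in r^{\mathcal{I}}$; $w=\bar r$ requires $(d_{i+1},d_i)\in r^{\mathcal{I}}$; $w=C?$ requires $d_i=d_{i+1}\in C^{\mathcal{I}}$; $w=\mathfrak{B}?$ requires $d_i=d_{i+1}$ and an accepting run of $\mathfrak{B}$ from $d_i$. Accepting if $q_\ell$ is final. $\mathcal{A}\models\exists x\,\mathfrak{A}(a,x)$ means there is an accepting run of $\mathfrak{A}$ from $a$ in $\mathcal{A}$ regarded as an interpretation (database). Construction of $\mathfrak{A}_A=(Q,\Sigma,\delta,q_0,F)$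 for a concept name $A$ of height $n$, by induction on $n$ (assuming $\mathfrak{A}_B$ built for all $B\in\mathrm{con}(\mathcal{T}|_{n-1})$): $\Sigma=\{B?\mid B\in\mathrm{con}(\mathcal{T}|_n)\}\cup\mathrm{rol}(\mathcal{T}|_n)\cup\{\mathfrak{A}_B?\mid B\in\mathrm{con}(\mathcal{T}|_{n-1})\}$; $Q$ consists of pairs $(P,g)$ with $P\subseteq\mathrm{con}(\mathcal{T}|_n)$, $g\in\mathrm{con}(\mathcal{T}|_n)$; $q_0=(\{\top\},A)$; $F=\{(P,g)\mid g\in P\text{ or }\bot\in P\}$. $\delta$ is the least relation such that for each state $(P,g)$: (weak) for each $P'\subseteq P$, $((P,g),\top?,(P'\cup\{\top\},g))\in\delta$; (data) for each $B\in\mathrm{con}(\mathcal{T}|_n)$, $((P,g),B?,(P\cup\{B\},g))\in\delta$; (sbus) for each GCI $C\sqsubseteq D$ in $\mathcal{T}|_n$ with $g=D$, $((P,g),\top?,(P,C))\in\delta$; (succ) for each GCI $\exists s.C\sqsubseteq D$ in $\mathcal{T}|_n$ with $g=D$, $((P,g),s,(\{\top\},C))\in\delta$; (anon) for all $B,D\in\mathrm{con}(\mathcal{T}|_n)$ with $g=D$ and $(\{C(a)\mid C\in P\cup\{B\}\},\mathcal{T}|_n)\models D(a)$, $((P,g),\top?,(P,B))\in\delta$; and, if $n>0$: (noc) for each GCI $B\sqcap C\sqsubseteq D$ in $\mathcal{T}|_n$ with $B\in P$ and $g=D$, $((P,g),\top?,(P,C))\in\delta$ (and symmetrically with $C\in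 P$, going to $(P,B)$); (aut) for each $B\in\mathrm{con}(\mathcal{T}|_{n-1})$, $((P,g),\mathfrak{A}_B?,(P\cup\{B\},g))\in\delta$. -}

module Defs where

import Level
open import Level using (Lift)
open import Data.Nat using (ℕ; zero; suc; _≤_)
open import Data.Product using (Σ; _×_; _,_; ∃)
open import Data.Sum using (_⊎_; inj₁; inj₂)
open import Data.Unit using (⊤)
open import Data.Empty using (⊥)
open import Data.List using (List; []; _∷_)
open import Data.List.Membership.Propositional using (_∈_)
open import Data.List.Relation.Unary.All using (All)
open import Data.List.Relation.Binary.Subset.Propositional using (_⊆_)
open import Relation.Binary.PropositionalEquality using (_≡_; _≢_)
open import Relation.Binary.Structures using (IsPreorder)
open import Relation.Nullary using (¬_)

data Atom (CN : Set) : Set where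
  top bot : Atom CN
  name    : CN → Atom CN

data Role (RN : Set) : Set where
  rn inv : RN → Role RN

roleName : {RN : Set} → Role RN → RN
roleName (rn r)  = r
roleName (inv r) = r

Sym : Set → Set → Set
Sym CN RN = Atom CN ⊎ Role RN

data GCI (CN RN : Set) : Set where
  incl : Atom CN → Atom CN → GCI CN RN               -- A ⊑ B
  conj : CN → CN → CN → GCI CN RN                    -- A ⊓ B ⊑ C  (no ⊤,⊥)
  exR  : Atom CN → Role RN → Atom CN → GCI CN RN     -- A ⊑ ∃s.B
  exL  : Role RN → Atom CN → Atom CN → GCI CN RN     -- ∃s.A ⊑ B

TBox : Set → Set → Set
TBox CN RN = List (GCI CN RN)

NF : {CN RN : Set} → GCI CN RN → Set
NF (incl A B)   = ⊤
NF (conj A B C) = ⊤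
NF (exR A s B)  = B ≢ bot
NF (exL s A B)  = A ≢ bot

NormalForm : {CN RN : Set} → TBox CN RN → Set
NormalForm T = ∀ γ → γ ∈ T → NF γ

atomsOf : {CN RN : Set} → GCI CN RN → List (Atom CN)
atomsOf (incl A B)   = A ∷ B ∷ []
atomsOf (conj A B C) = name A ∷ name B ∷ name C ∷ []
atomsOf (exR A s B)  = A ∷ B ∷ []
atomsOf (exL s A B)  = A ∷ B ∷ []

rolesOf : {CN RN : Set} → GCI CN RN → List (Role RN)
rolesOf (incl A B)   = []
rolesOf (conj A B C) = []
rolesOf (exR A s B)  = s ∷ []
rolesOf (exL s A B)  = s ∷ []

record Interp (CN RN Δ : Set) : Set₁ where
  field
    conc : CN → Δ → Set
    role : RN → Δ → Δ → Set

module _ {CN RN Δ : Set} (I : Interp CN RN Δ) where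
  open Interp I

  ⟦_⟧ : Atom CN → Δ → Set
  ⟦ top ⟧    d = ⊤
  ⟦ bot ⟧    d = ⊥
  ⟦ name A ⟧ d = conc A d

  rel : Role RN → Δ → Δ → Set
  rel (rn r)  d e = role r d e
  rel (inv r) d e = role r e d

  SatGCI : GCI CN RN → Set
  SatGCI (incl A B)   = ∀ d → ⟦ A ⟧ d → ⟦ B ⟧ d
  SatGCI (conj A B C) = ∀ d → conc A d → conc B d → conc C d
  SatGCI (exR A s B)  = ∀ d → ⟦ A ⟧ d → ∃ λ e → rel s d e × ⟦ B ⟧ e
  SatGCI (exL s A B)  = ∀ d e → rel s d e → ⟦ A ⟧ e → ⟦ B ⟧ d

  Model : TBox CN RN → Set
  Model T = ∀ γ → γ ∈ T → SatGCI γ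

data Assertion (CN RN Ind : Set) : Set where
  cas : CN → Ind → Assertion CN RN Ind
  ras : RN → Ind → Ind → Assertion CN RN Ind

ABox : Set → Set → Set → Set
ABox CN RN Ind = List (Assertion CN RN Ind)

SatAs : {CN RN Ind Δ : Set} → Interp CN RN Δ → (Ind → Δ) → Assertion CN RN Ind → Set
SatAs I ι (cas A a)   = Interp.conc I A (ι a)
SatAs I ι (ras r a b) = Interp.role I r (ι a) (ι b)

Entails : {CN RN Ind : Set} → TBox CN RN → ABox CN RN Ind → CN → Ind → Set₁
Entails {CN} {RN} {Ind} T 𝒜 A a =
  (Δ : Set) (I : Interp CN RN Δ) (ι : Ind → Δ) →
  Model I T → (∀ α → α ∈ 𝒜 → SatAs I ι α) → Interp.conc I A (ι a)

-- the ABox regarded as an interpretation (database)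
DB : {CN RN Ind : Set} → ABox CN RN Ind → Interp CN RN Ind
DB 𝒜 = record { conc = λ A a → cas A a ∈ 𝒜 ; role = λ r a b → ras r a b ∈ 𝒜 }

module _ {CN RN : Set} (T : TBox CN RN) (_≼_ : Sym CN RN → Sym CN RN → Set) where

  Dom : Sym CN RN → Set
  Dom (inj₁ a) = a ≡ top ⊎ a ≡ bot ⊎ Σ (GCI CN RN) (λ γ → γ ∈ T × a ∈ atomsOf γ)
  Dom (inj₂ s) = Σ (GCI CN RN) (λ γ → γ ∈ T × Σ (Role RN) (λ s' → s' ∈ rolesOf γ × roleName s' ≡ roleName s))

  _≺_ : Sym CN RN → Sym CN RN → Set
  α ≺ β = α ≼ β × ¬ (β ≼ α)

  StratGCI : GCI CN RN → Set
  StratGCI (incl (name A) (name B)) = inj₁ (name A) ≼ inj₁ (name B)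
  StratGCI (incl _ _) = ⊤
  StratGCI (conj A B C) =
    inj₁ (name A) ≼ inj₁ (name C) × inj₁ (name B) ≼ inj₁ (name C) ×
    (inj₁ (name A) ≺ inj₁ (name C) ⊎ inj₁ (name B) ≺ inj₁ (name C))
  StratGCI (exR (name A) s D) =
    (inj₁ (name A) ≼ inj₁ D ⊎ D ≡ top) × inj₁ (name A) ≼ inj₂ s
  StratGCI (exR _ s D) = ⊤
  StratGCI (exL s D (name B)) =
    (inj₁ D ≺ inj₁ (name B) ⊎ D ≡ name B ⊎ D ≡ top) × inj₂ s ≼ inj₁ D
  StratGCI (exL s D _) = ⊤

  Stratified : Set
  Stratified =
    IsPreorder _≡_ _≼_ ×
    (∀ γ → γ ∈ T → StratGCI γ) ×
    (∀ r → Dom (inj₂ (rn r)) → (inj₂ (rn r) ≼ inj₂ (inv r)) × (inj₂ (inv r) ≼ inj₂ (rn r)))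

  data SChain : ℕ → Sym CN RN → Set where
    start : ∀ {α} → Dom α → SChain zero α
    ext   : ∀ {k α β} → SChain k α → α ≺ β → Dom β → SChain (suc k) β

  Ht≤ : Sym CN RN → ℕ → Set
  Ht≤ (inj₁ top) n = ⊤
  Ht≤ (inj₁ bot) n = ⊤
  Ht≤ α n = ∀ k → SChain k α → k ≤ n

  IsHeight : Sym CN RN → ℕ → Set
  IsHeight (inj₁ top) n = n ≡ 0
  IsHeight (inj₁ bot) n = n ≡ 0
  IsHeight α n = SChain n α × Ht≤ α n

  InT : ℕ → GCI CN RN → Set
  InT n γ = γ ∈ T × All (λ a → Ht≤ (inj₁ a) n) (atomsOf γ) × All (λ s → Ht≤ (inj₂ s) n) (rolesOf γ)

  Con : ℕ → Atom CN → Set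
  Con n a = a ≡ top ⊎ a ≡ bot ⊎ Σ (GCI CN RN) (λ γ → InT n γ × a ∈ atomsOf γ)

  EntailsAt : ℕ → List (Atom CN) → Atom CN → Set₁
  EntailsAt n P D = (Δ : Set) (I : Interp CN RN Δ) → (∀ γ → InT n γ → SatGCI I γ) →
                    ∀ d → All (λ C → ⟦ I ⟧ C d) P → ⟦ I ⟧ D d

  -- The nested NFA 𝔄_A  (finite sets P represented by lists)

  State : Set
  State = List (Atom CN) × Atom CN

  InQ : ℕ → State → Set
  InQ n (P , g) = All (Con n) P × Con n g

  data Letter : Set where
    tst : Atom CN → Letter
    rl  : Role RN → Letter
    au  : Atom CN → Letter     -- 𝔄_B?

  data Trans : ℕ → State → Letter → State → Set₁ where
    weak : ∀ {n P g P'} → InQ n (P , g) → P' ⊆ P →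
           Trans n (P , g) (tst top) (top ∷ P' , g)
    dat  : ∀ {n P g B} → InQ n (P , g) → Con n B →
           Trans n (P , g) (tst B) (B ∷ P , g)
    sbus : ∀ {n P C D} → InQ n (P , D) → InT n (incl C D) →
           Trans n (P , D) (tst top) (P , C)
    succ : ∀ {n P s C D} → InQ n (P , D) → InT n (exL s C D) →
           Trans n (P , D) (rl s) (top ∷ [] , C)
    anon : ∀ {n P B D} → InQ n (P , D) → Con n B → Con n D → EntailsAt n (B ∷ P) D →
           Trans n (P , D) (tst top) (P , B)
    nocˡ : ∀ {k P B C D} → InQ (suc k) (P , name D) → InT (suc k) (conj B C D) → name B ∈ P →
           Trans (suc k) (P , name D) (tst top) (P , name C)
    nocʳ : ∀ {k P B C D} → InQ (suc k) (P , name D) → InT (suc k) (conj B C D) → name C ∈ P →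
           Trans (suc k) (P , name D) (tst top) (P , name B)
    aut  : ∀ {k P g B} → InQ (suc k) (P , g) → Con k B →
           Trans (suc k) (P , g) (au B) (B ∷ P , g)

  Final : State → Set
  Final (P , g) = g ∈ P ⊎ bot ∈ P

  module _ {Δ : Set} (I : Interp CN RN Δ) where

    -- runs of the height-n automaton in I; O B d interprets the test 𝔄_B? at d
    data Path (n : ℕ) (O : Atom CN → Δ → Set₁) : State → Δ → State → Δ → Set₁ where
      here  : ∀ {q d} → Path n O q d q d
      tstep : ∀ {q q₁ q' C d e} → Trans n q (tst C) q₁ → ⟦ I ⟧ C d →
              Path n O q₁ d q' e → Path n O q d q' e
      rstep : ∀ {q q₁ q' s d d₁ e} → Trans n q (rl s) q₁ → rel I s d d₁ →
              Path n O q₁ d₁ q' e → Path n O q d q' e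
      astep : ∀ {q q₁ q' B d e} → Trans n q (au B) q₁ → O B d →
              Path n O q₁ d q' e → Path n O q d q' e

    Run : ℕ → (Atom CN → Δ → Set₁) → Atom CN → Δ → Set₁
    Run n O B d = Σ State λ q → Σ Δ λ e → Path n O (top ∷ [] , B) d q e × Final q

    -- Lower n B d : B has height k < n and 𝔄_B has an accepting run from d
    Lower : ℕ → Atom CN → Δ → Set₁
    Lower zero    B d = Lift (Level.suc Level.zero) ⊥
    Lower (suc k) B d = Lower k B d ⊎ (Lift (Level.suc Level.zero) (IsHeight (inj₁ B) k) × Run k (Lower k) B d)

    AccRun : ℕ → Atom CN → Δ → Set₁
    AccRun n A d = Run n (Lower n) A d

-- A state (P , g) of 𝔄_A is read at an element d as the implication "if all
-- concepts of P hold at d then g holds at d".  In every model of T each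
-- transition preserves this reading backwards: (sbus), (succ) and (noc) apply a
-- GCI of T, (anon) is an entailment of T|ₙ, and (weak), (data) and (aut) only
-- shrink P or add to it facts that hold.  Accepting states make the implication
-- trivially true and the initial state ({⊤} , A) reads as A itself, so an
-- accepting run from d forces A at d; the nested tests 𝔄_B? are handled by
-- induction on the height.  A run in the ABox is transported into an arbitrary
-- model of (𝒜 , T) along the interpretation of the individuals, which is a
-- homomorphism.
{-# OPTIONS --safe #-}
module Submission where

open import Defs
open import Data.Nat using (ℕ; zero; suc)
open import Data.Sum using (inj₁; inj₂)
open import Data.Product using (_,_; proj₁)
open import Data.Unit using (tt)
open import Data.Empty using (⊥-elim)
open import Data.List using (List; []; _∷_)
open import Data.List.Membership.Propositional using (_∈_)
open import Data.List.Relation.Unary.All using (All; []; _∷_; lookup)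
open import Data.List.Relation.Unary.All.Properties using (anti-mono)
open import Level using (lift)

record Homomorphism {CN RN Δ Δ′ : Set} (I : Interp CN RN Δ) (J : Interp CN RN Δ′) : Set where
  field
    ⟪_⟫      : Δ → Δ′
    conc-hom : ∀ A d → Interp.conc I A d → Interp.conc J A ⟪ d ⟫
    role-hom : ∀ r d e → Interp.role I r d e → Interp.role J r ⟪ d ⟫ ⟪ e ⟫

  atom-hom : ∀ C d → ⟦ I ⟧ C d → ⟦ J ⟧ C ⟪ d ⟫
  atom-hom top      d _  = tt
  atom-hom (name A) d Ad = conc-hom A d Ad

  rel-hom : ∀ s d e → rel I s d e → rel J s ⟪ d ⟫ ⟪ e ⟫
  rel-hom (rn r)  d e = role-hom r d e
  rel-hom (inv r) d e = role-hom r e d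

satisfies⇒DB-homomorphism : {CN RN Ind Δ : Set} {𝒜 : ABox CN RN Ind} {J : Interp CN RN Δ}
  (ι : Ind → Δ) → (∀ α → α ∈ 𝒜 → SatAs J ι α) → Homomorphism (DB 𝒜) J
satisfies⇒DB-homomorphism ι J⊨𝒜 = record
  { ⟪_⟫      = ι
  ; conc-hom = λ A a → J⊨𝒜 (cas A a)
  ; role-hom = λ r a b → J⊨𝒜 (ras r a b)
  }

module RunSoundness {CN RN Δ Δ′ : Set} (T : TBox CN RN) (_≼_ : Sym CN RN → Sym CN RN → Set)
  {I : Interp CN RN Δ} {J : Interp CN RN Δ′} (h : Homomorphism I J) (J⊨T : Model J T) where

  open Homomorphism h

  HoldsAll : List (Atom CN) → Δ → Set
  HoldsAll P d = All (λ C → ⟦ J ⟧ C ⟪ d ⟫) P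

  Valid : State T _≼_ → Δ → Set
  Valid (P , g) d = HoldsAll P d → ⟦ J ⟧ g ⟪ d ⟫

  SoundOracle : (Atom CN → Δ → Set₁) → Set₁
  SoundOracle O = ∀ B d → O B d → ⟦ J ⟧ B ⟪ d ⟫

  final⇒valid : ∀ {q} d → Final T _≼_ q → Valid q d
  final⇒valid d (inj₁ g∈P) P-holds = lookup P-holds g∈P
  final⇒valid d (inj₂ ⊥∈P) P-holds = ⊥-elim (lookup P-holds ⊥∈P)

  test-step-valid : ∀ {n q q₁ C d} → Trans T _≼_ n q (tst C) q₁ → ⟦ I ⟧ C d →
                    Valid q₁ d → Valid q d
  test-step-valid (weak _ P′⊆P)                   _  v P-holds = v (tt ∷ anti-mono P′⊆P P-holds)
  test-step-valid {d = d} (dat {B = B} _ _)       Bd v P-holds = v (atom-hom B d Bd ∷ P-holds)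
  test-step-valid {d = d} (sbus _ (C⊑D∈T , _))    _  v P-holds = J⊨T _ C⊑D∈T ⟪ d ⟫ (v P-holds)
  test-step-valid {d = d} (anon _ _ _ B∷P⊨D)      _  v P-holds =
    B∷P⊨D _ J (λ γ γ∈Tₙ → J⊨T γ (proj₁ γ∈Tₙ)) ⟪ d ⟫ (v P-holds ∷ P-holds)
  test-step-valid {d = d} (nocˡ _ (B⊓C⊑D∈T , _) B∈P) _ v P-holds =
    J⊨T _ B⊓C⊑D∈T ⟪ d ⟫ (lookup P-holds B∈P) (v P-holds)
  test-step-valid {d = d} (nocʳ _ (B⊓C⊑D∈T , _) C∈P) _ v P-holds =
    J⊨T _ B⊓C⊑D∈T ⟪ d ⟫ (v P-holds) (lookup P-holds C∈P)

  role-step-valid : ∀ {n q q₁ s d d₁} → Trans T _≼_ n q (rl s) q₁ → rel I s d d₁ →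
                    Valid q₁ d₁ → Valid q d
  role-step-valid {d = d} {d₁} (succ {s = s} _ (∃sC⊑D∈T , _)) sdd₁ v _ =
    J⊨T _ ∃sC⊑D∈T ⟪ d ⟫ ⟪ d₁ ⟫ (rel-hom s d d₁ sdd₁) (v (tt ∷ []))

  oracle-step-valid : ∀ {n O q q₁ B d} → SoundOracle O → Trans T _≼_ n q (au B) q₁ → O B d →
                      Valid q₁ d → Valid q d
  oracle-step-valid {d = d} O-sound (aut {B = B} _ _) OBd v P-holds = v (O-sound B d OBd ∷ P-holds)

  path-reflects-valid : ∀ {n O q d q′ e} → SoundOracle O →
                        Path T _≼_ I n O q d q′ e → Valid q′ e → Valid q d
  path-reflects-valid O-sound here            v = v
  path-reflects-valid O-sound (tstep t Cd p)  v = test-step-valid t Cd (path-reflects-valid O-sound p v)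
  path-reflects-valid O-sound (rstep t sdd p) v = role-step-valid t sdd (path-reflects-valid O-sound p v)
  path-reflects-valid O-sound (astep t OBd p) v =
    oracle-step-valid O-sound t OBd (path-reflects-valid O-sound p v)

  run-sound : ∀ {n O} → SoundOracle O → SoundOracle (Run T _≼_ I n O)
  run-sound O-sound B d (q , e , p , final) =
    path-reflects-valid O-sound p (final⇒valid e final) (tt ∷ [])

  lower-sound : ∀ n → SoundOracle (Lower T _≼_ I n)
  lower-sound zero    B d (lift ())
  lower-sound (suc k) B d (inj₁ lower) = lower-sound k B d lower
  lower-sound (suc k) B d (inj₂ (_ , run)) = run-sound (lower-sound k) B d run

  accRun-sound : ∀ n → SoundOracle (AccRun T _≼_ I n)
  accRun-sound n = run-sound (lower-sound n)

lemma4p1 : {CN RN Ind : Set} (T : TBox CN RN) (_≼_ : Sym CN RN → Sym CN RN → Set) →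
    NormalForm T → Stratified T _≼_ →
    (A : CN) (n : ℕ) → IsHeight T _≼_ (inj₁ (name A)) n →
    (𝒜 : ABox CN RN Ind) (a : Ind) →
    AccRun T _≼_ (DB 𝒜) n (name A) a → Entails T 𝒜 A a
lemma4p1 T _≼_ _ _ A n _ 𝒜 a run Δ J ι J⊨T J⊨𝒜 =
  RunSoundness.accRun-sound T _≼_ (satisfies⇒DB-homomorphism ι J⊨𝒜) J⊨T n (name A) a run
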